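{- Let $G$ be a group generated as a monoid by a subset $A\subseteq G$ closed under $G$-conjugation, and let $c\in G$ with $\ell_A(c)=2$ and $\mathrm{Red}_A(c)$ finite. Let $\mathrm{orb}(c)$ be the number of Hurwitz orbits of $\mathrm{Red}_A(c)$. Then $$\mathrm{orb}(c)=\min\{\mathrm{rise}(c;\prec): \prec \text{ a linear order on } A_c\}.$$ In particular, there exists a linear order $\prec$ of $A_c$ such that the number of Hurwitz orbits of $\mathrm{Red}_A(c)$ equals the number of $\prec$-rising reduced $A$-factorizations of $c$.
   Context: For $x\in G$, $\ell_A(x)$ is the least $k\ge 0$ such that $x$ is a product of $k$ elements of $A$; such a product with $k=\ell_A(x)$, written as a tuple, is a reduced $A$-factorization, and $\mathrm{Red}_A(x)$ is the set of these. $x\le_A y$ iff $\ell_A(x)+\ell_A(x^{ -1}y)=\ell_A(y)$, and $A_c=\{a\in A: a\le_A c\}$. The Hurwitz action of $B_2=\langle\sigma_1\rangle$ on $\mathrm{Red}_A(c)$ is $\sigma_1\cdot(a_1,a_2)=(a_2,a_2^{ -1}a_1a_2)$. For a linear order $\prec$ on $A_c$, a factorization $(a_1,\dots,a_n)\in\mathrm{Red}_A(c)$ is $\prec$-rising if $a_i\preceq a_{i+1}$ for all $i$; $\mathrm{rise}(c;\prec)$ is the number of $\prec$-rising elements of $\mathrm{Red}_A(c)$. -}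

module Defs where

open import Level using (Level; _⊔_)
open import Algebra.Bundles using (Group)
open import Data.Nat using (ℕ; zero; suc; _+_; _≤_)
open import Data.Integer using (ℤ; +_; -[1+_])
open import Data.Fin using (Fin)
open import Data.List using (List; []; _∷_; length; foldr)
open import Data.List.Relation.Unary.All using (All)
open import Data.List.Relation.Binary.Pointwise using (Pointwise)
open import Data.Product using (Σ; ∃; ∃-syntax; _×_; proj₁)
open import Data.Unit.Polymorphic using (⊤)
open import Relation.Unary using (Pred)
open import Relation.Binary using (Rel)
open import Relation.Binary.Structures using (IsTotalOrder)
open import Relation.Binary.PropositionalEquality using (_≡_)

-- For an equivalence relation R this says: X/R has exactly n elements.
HasCard : ∀ {a r} (X : Set a) (R : Rel X r) → ℕ → Set (a ⊔ r)
HasCard X R n =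
  Σ (Fin n → X) λ f →
    (∀ i j → R (f i) (f j) → i ≡ j) × (∀ x → ∃[ i ] R (f i) x)

module _ {c ℓ : Level} (G : Group c ℓ) where
  open Group G

  prod : List Carrier → Carrier
  prod = foldr _∙_ ε

  module _ {a : Level} (A : Pred Carrier a) where

    ProductOf : Carrier → ℕ → Set (c ⊔ ℓ ⊔ a)
    ProductOf x k = ∃[ w ] (length w ≡ k × All A w × prod w ≈ x)

    IsLength : Carrier → ℕ → Set (c ⊔ ℓ ⊔ a)
    IsLength x k =
      ProductOf x k × (∀ w → All A w → prod w ≈ x → k ≤ length w)

    _≤A_ : Carrier → Carrier → Set (c ⊔ ℓ ⊔ a)
    x ≤A y = ∃[ i ] ∃[ j ] ∃[ k ]
      (IsLength x i × IsLength (x ⁻¹ ∙ y) j × IsLength y k × i + j ≡ k)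

    IsRed : Carrier → List Carrier → Set (c ⊔ ℓ ⊔ a)
    IsRed x w = All A w × prod w ≈ x × IsLength x (length w)

    Red : Carrier → Set (c ⊔ ℓ ⊔ a)
    Red x = Σ (List Carrier) (IsRed x)

    _≈Red_ : ∀ {x} → Rel (Red x) (c ⊔ ℓ)
    u ≈Red v = Pointwise _≈_ (proj₁ u) (proj₁ v)

    Sub : Carrier → Set (c ⊔ ℓ ⊔ a)
    Sub x = Σ Carrier λ b → A b × b ≤A x

    _≈Sub_ : ∀ {x} → Rel (Sub x) ℓ
    u ≈Sub v = proj₁ u ≈ proj₁ v

  hurwitz : List Carrier → List Carrier
  hurwitz (x ∷ y ∷ rest) = y ∷ ((y ⁻¹ ∙ x) ∙ y) ∷ rest
  hurwitz w = w

  hurwitzInv : List Carrier → List Carrier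
  hurwitzInv (x ∷ y ∷ rest) = ((x ∙ y) ∙ x ⁻¹) ∷ x ∷ rest
  hurwitzInv w = w

  iter : (List Carrier → List Carrier) → ℕ → List Carrier → List Carrier
  iter f zero w = w
  iter f (suc n) w = f (iter f n w)

  -- action of σ₁^z, z ∈ ℤ (B₂ ≅ ℤ)
  act : ℤ → List Carrier → List Carrier
  act (+ n) = iter hurwitz n
  act -[1+ n ] = iter hurwitzInv (suc n)

  module _ {a : Level} (A : Pred Carrier a) where
    SameOrbit : ∀ {x} → Rel (Red A x) (c ⊔ ℓ)
    SameOrbit u v = ∃[ z ] Pointwise _≈_ (act z (proj₁ u)) (proj₁ v)

    Rising : ∀ {o} (x : Carrier) → Rel (Sub A x) o → List Carrier → Set (c ⊔ ℓ ⊔ a ⊔ o)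
    Rising x _≼_ [] = ⊤
    Rising x _≼_ (y ∷ []) = ⊤
    Rising x _≼_ (y ∷ z ∷ rest) =
      Σ (A y × _≤A_ A y x) λ py → Σ (A z × _≤A_ A z x) λ pz →
        ((y , py) ≼ (z , pz)) × Rising x _≼_ (z ∷ rest)
      where open Data.Product using (_,_)

    RisingRed : ∀ {o} (x : Carrier) → Rel (Sub A x) o → Set (c ⊔ ℓ ⊔ a ⊔ o)
    RisingRed x _≼_ = Σ (Red A x) λ u → Rising x _≼_ (proj₁ u)

    _≈Rising_ : ∀ {o} {x : Carrier} {_≼_ : Rel (Sub A x) o} → Rel (RisingRed x _≼_) (c ⊔ ℓ)
    u ≈Rising v = Pointwise _≈_ (proj₁ (proj₁ u)) (proj₁ (proj₁ v))

    IsLinearOrder : ∀ {o} (x : Carrier) → Rel (Sub A x) o → Set (c ⊔ ℓ ⊔ a ⊔ o)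
    IsLinearOrder x _≼_ = IsTotalOrder (_≈Sub_ A {x}) _≼_

module Submission where

-- Since ℓ_A(c) = 2, every reduced factorization of c is a pair (b , b⁻¹c),
-- determined by its first letter b ∈ A_c; the Hurwitz move sends (x , y) to
-- (y , y⁻¹xy), so the first letter of σ₁·u is the second letter of u, and u is
-- ≼-rising exactly when first(u) ≼ first(σ₁·u).  Enumerating Red_A(c) by Fin m,
-- σ₁ becomes a permutation σ of Fin m whose cycles are the Hurwitz orbits, and
-- the rising factorizations are the points j with first(j) ≼ first(σ j).
-- The theorem then follows from two facts about cycles of a permutation:
--  (1) for every total order some point of each cycle is a rise, since going
--      once around a cycle cannot strictly descend; so orb(c) ≤ rise(c;≼);
--  (2) ordering points by (cycle, descending distance from a chosen point of
--      the cycle) gives exactly one rise per cycle, so equality is attained.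

open import Defs
open import Level using (Level; _⊔_; 0ℓ; Lift; lift; lower)
open import Algebra.Bundles using (Group)
import Algebra.Properties.Group as GroupProperties
open import Data.Nat using (ℕ; zero; suc; _+_; _*_; _≤_; _<_; _≥_; z≤n; s≤s)
import Data.Nat.Properties as ℕₚ
open import Data.Fin using (Fin; toℕ)
import Data.Fin.Properties as Finₚ
open import Data.List using (List; []; _∷_; length)
open import Data.List.Relation.Unary.All using (All; []; _∷_)
open import Data.List.Relation.Binary.Pointwise as Pointwise using (Pointwise; []; _∷_)
open import Data.Maybe using (Maybe; just; nothing)
import Data.Maybe.Properties as Maybeₚ
open import Data.Product using (Σ; ∃; ∃₂; ∃-syntax; _×_; _,_; proj₁; proj₂)
open import Data.Product.Relation.Binary.Lex.NonStrict using (×-Lex; ×-isTotalOrder)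
import Data.Product.Relation.Binary.Pointwise.NonDependent as ×-Pointwise
open import Data.Sum as Sum using (_⊎_; inj₁; inj₂)
open import Data.Empty using (⊥-elim)
open import Data.Unit.Polymorphic using (tt)
open import Data.Integer using (ℤ; +_; -[1+_])
open import Relation.Unary using (Pred)
open import Relation.Binary using (Rel; IsEquivalence; Reflexive; Transitive; Total)
open import Relation.Binary.Structures using (IsTotalOrder)
import Relation.Binary.Construct.On as On
import Relation.Binary.Construct.Flip.EqAndOrd as Flip
open import Relation.Binary.PropositionalEquality as ≡ using (_≡_)
open import Relation.Nullary using (¬_; Dec; yes; no)

Least : ∀ {p} (P : ℕ → Set p) → ℕ → Set p
Least P n = P n × (∀ t → t < n → ¬ P t)

least-≤ : ∀ {p} {P : ℕ → Set p} {n t} → Least P n → P t → n ≤ t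
least-≤ (_ , below) Pt = ℕₚ.≮⇒≥ (λ t<n → below _ t<n Pt)

fails-below-suc : ∀ {p} {P : ℕ → Set p} {N} →
  (∀ t → t < N → ¬ P t) → ¬ P N → ∀ t → t < suc N → ¬ P t
fails-below-suc none ¬PN t t<1+N with ℕₚ.m<1+n⇒m<n∨m≡n t<1+N
... | inj₁ t<N    = none t t<N
... | inj₂ ≡.refl = ¬PN

search-below : ∀ {p} {P : ℕ → Set p} → (∀ n → Dec (P n)) →
  ∀ N → (∀ t → t < N → ¬ P t) ⊎ ∃ (Least P)
search-below P? zero = inj₁ (λ _ ())
search-below P? (suc N) with search-below P? N | P? N
... | inj₂ found | _      = inj₂ found
... | inj₁ none  | yes PN = inj₂ (N , PN , none)
... | inj₁ none  | no ¬PN = inj₁ (fails-below-suc none ¬PN)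

least-witness : ∀ {p} {P : ℕ → Set p} → (∀ n → Dec (P n)) → ∀ {n} → P n → ∃ (Least P)
least-witness P? {n} Pn with search-below P? (suc n)
... | inj₁ none  = ⊥-elim (none n (ℕₚ.n<1+n n) Pn)
... | inj₂ found = found

pullback-isTotalOrder : ∀ {s t e₁ e₂ r} o {S : Set s} {T : Set t}
  {_≈_ : Rel S e₁} {_≋_ : Rel T e₂} {_≤_ : Rel T r} →
  IsEquivalence _≈_ → IsTotalOrder _≋_ _≤_ → (key : S → T) →
  (∀ {x y} → x ≈ y → key x ≋ key y) → (∀ {x y} → key x ≋ key y → x ≈ y) →
  IsTotalOrder _≈_ (λ x y → Lift o (key x ≤ key y))
pullback-isTotalOrder o ≈-equivalence ≤-total key preserves reflects = record
  { isPartialOrder = record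
    { isPreorder = record
      { isEquivalence = ≈-equivalence
      ; reflexive     = λ x≈y → lift (reflexive (preserves x≈y))
      ; trans         = λ x≤y y≤z → lift (trans (lower x≤y) (lower y≤z))
      }
    ; antisym = λ x≤y y≤x → reflects (antisym (lower x≤y) (lower y≤x))
    }
  ; total = λ x y → Sum.map lift lift (total (key x) (key y))
  }
  where open IsTotalOrder ≤-total

_⊑_ : Rel (ℕ × ℕ) 0ℓ
_⊑_ = ×-Lex _≡_ _≤_ _≥_

⊑-isTotalOrder : IsTotalOrder (×-Pointwise.Pointwise _≡_ _≡_) _⊑_
⊑-isTotalOrder =
  ×-isTotalOrder ℕₚ._≟_ ℕₚ.≤-isTotalOrder (Flip.isTotalOrder ℕₚ.≤-isTotalOrder)

module Enumeration {x r n} {X : Set x} {_≈_ : Rel X r}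
  (≈-equivalence : IsEquivalence _≈_) (card : HasCard X _≈_ n) where

  open IsEquivalence ≈-equivalence

  enum : Fin n → X
  enum = proj₁ card

  enum-injective : ∀ i j → enum i ≈ enum j → i ≡ j
  enum-injective = proj₁ (proj₂ card)

  index : X → Fin n
  index u = proj₁ (proj₂ (proj₂ card) u)

  enum-index : ∀ u → enum (index u) ≈ u
  enum-index u = proj₂ (proj₂ (proj₂ card) u)

  index-enum : ∀ i → index (enum i) ≡ i
  index-enum i = enum-injective _ _ (enum-index (enum i))

  index-resp : ∀ {u v} → u ≈ v → index u ≡ index v
  index-resp {u} {v} u≈v =
    enum-injective _ _ (trans (enum-index u) (trans u≈v (sym (enum-index v))))

  index-injective : ∀ {u v} → index u ≡ index v → u ≈ v
  index-injective {u} {v} e =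
    trans (sym (enum-index u)) (≡.subst (λ i → enum i ≈ v) (≡.sym e) (enum-index v))

module Permutation {m : ℕ} (σ σ⁻ : Fin m → Fin m)
  (σ⁻∘σ : ∀ j → σ⁻ (σ j) ≡ j) (σ∘σ⁻ : ∀ j → σ (σ⁻ j) ≡ j) where

  σ^ : ℕ → Fin m → Fin m
  σ^ zero    j = j
  σ^ (suc n) j = σ (σ^ n j)

  σ-injective : ∀ {i j} → σ i ≡ σ j → i ≡ j
  σ-injective {i} {j} e = ≡.trans (≡.sym (σ⁻∘σ i)) (≡.trans (≡.cong σ⁻ e) (σ⁻∘σ j))

  σ^-+ : ∀ n p j → σ^ (n + p) j ≡ σ^ n (σ^ p j)
  σ^-+ zero    p j = ≡.refl
  σ^-+ (suc n) p j = ≡.cong σ (σ^-+ n p j)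

  σ^-injective : ∀ n {i j} → σ^ n i ≡ σ^ n j → i ≡ j
  σ^-injective zero    e = e
  σ^-injective (suc n) e = σ^-injective n (σ-injective e)

  -- Every point is periodic: two of σ⁰ j, …, σᵐ j coincide (pigeonhole),
  -- and cancelling the smaller power gives σ^(1+p) j = j.
  period : ∀ j → ∃ λ p → σ^ (suc p) j ≡ j
  period j with Finₚ.pigeonhole (ℕₚ.n<1+n m) (λ t → σ^ (toℕ t) j)
  ... | s , t , s<t , σˢ≡σᵗ with ℕₚ.m≤n⇒∃[o]m+o≡n s<t
  ...   | p , 1+s+p≡t = p , ≡.sym (σ^-injective (toℕ s) (begin
    σ^ (toℕ s) j                     ≡⟨ σˢ≡σᵗ ⟩
    σ^ (toℕ t) j                     ≡⟨ ≡.cong (λ n → σ^ n j) (≡.sym 1+s+p≡t) ⟩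
    σ^ (suc (toℕ s) + p) j           ≡⟨ ≡.cong (λ n → σ^ n j) (ℕₚ.+-suc (toℕ s) p) ⟨
    σ^ (toℕ s + suc p) j             ≡⟨ σ^-+ (toℕ s) (suc p) j ⟩
    σ^ (toℕ s) (σ^ (suc p) j)        ∎))
    where open ≡.≡-Reasoning

  period-multiple : ∀ {j} p → σ^ p j ≡ j → ∀ n → σ^ (n * p) j ≡ j
  period-multiple p σᵖj≡j zero    = ≡.refl
  period-multiple {j} p σᵖj≡j (suc n) =
    ≡.trans (σ^-+ p (n * p) j) (≡.trans (≡.cong (σ^ p) (period-multiple p σᵖj≡j n)) σᵖj≡j)

  Orb : Rel (Fin m) 0ℓ
  Orb i j = ∃ λ n → σ^ n i ≡ j

  Orb-refl : ∀ {j} → Orb j j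
  Orb-refl = 0 , ≡.refl

  Orb-trans : ∀ {i j l} → Orb i j → Orb j l → Orb i l
  Orb-trans {i} (n , σⁿi≡j) (p , σᵖj≡l) =
    p + n , ≡.trans (σ^-+ p n i) (≡.trans (≡.cong (σ^ p) σⁿi≡j) σᵖj≡l)

  -- Going n steps forward is undone by going on to a multiple of the period.
  Orb-sym : ∀ {i j} → Orb i j → Orb j i
  Orb-sym {i} (n , ≡.refl) with period i
  ... | p , σ¹⁺ᵖi≡i = n * p , (begin
    σ^ (n * p) (σ^ n i)    ≡⟨ σ^-+ (n * p) n i ⟨
    σ^ (n * p + n) i       ≡⟨ ≡.cong (λ t → σ^ t i) (ℕₚ.+-comm (n * p) n) ⟩
    σ^ (n + n * p) i       ≡⟨ ≡.cong (λ t → σ^ t i) (ℕₚ.*-suc n p) ⟨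
    σ^ (n * suc p) i       ≡⟨ period-multiple (suc p) σ¹⁺ᵖi≡i n ⟩
    i                      ∎)
    where open ≡.≡-Reasoning

  -- For a total preorder R, going once around a cycle cannot be a strict
  -- descent: either some step σ^t j ↦ σ^(t+1) j is an R-rise, or all of the
  -- first n+1 steps descend and so σ^(n+1) j R σ j.
  module Rises {r} (_R_ : Rel (Fin m) r)
    (R-refl : Reflexive _R_) (R-trans : Transitive _R_) (R-total : Total _R_) where

    rise-or-descent : ∀ n j → (∃ λ t → σ^ t j R σ (σ^ t j)) ⊎ σ^ (suc n) j R σ j
    rise-or-descent zero j = inj₂ R-refl
    rise-or-descent (suc n) j with rise-or-descent n j
    ... | inj₁ rise    = inj₁ rise
    ... | inj₂ descent with R-total (σ^ (suc n) j) (σ (σ^ (suc n) j))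
    ...   | inj₁ rise = inj₁ (suc n , rise)
    ...   | inj₂ step = inj₂ (R-trans step descent)

    rise-in-orbit : ∀ j → ∃ λ t → σ^ t j R σ (σ^ t j)
    rise-in-orbit j with period j
    ... | p , σ¹⁺ᵖj≡j with rise-or-descent p j
    ...   | inj₁ rise    = rise
    ...   | inj₂ descent = 0 , ≡.subst (_R σ j) σ¹⁺ᵖj≡j descent

  module Cycles {k : ℕ} (rep : Fin k → Fin m) (cls : Fin m → Fin k)
    (rep-cls : ∀ j → Orb (rep (cls j)) j)
    (cls-unique : ∀ {i j} → Orb (rep i) j → cls j ≡ i) where

    cls-rep : ∀ i → cls (rep i) ≡ i
    cls-rep i = cls-unique Orb-refl

    cls-σ : ∀ j → cls (σ j) ≡ cls j
    cls-σ j = cls-unique (Orb-trans (rep-cls j) (1 , ≡.refl))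

    rise-in-cycle : ∀ {r} (_R_ : Rel (Fin m) r) →
      Reflexive _R_ → Transitive _R_ → Total _R_ →
      ∀ i → ∃ λ j → cls j ≡ i × j R σ j
    rise-in-cycle _R_ R-refl R-trans R-total i
      with Rises.rise-in-orbit _R_ R-refl R-trans R-total (rep i)
    ... | t , rise = σ^ t (rep i) , cls-unique (t , ≡.refl) , rise

    depth-search : ∀ j → ∃ (Least (λ n → σ^ n (rep (cls j)) ≡ j))
    depth-search j =
      least-witness (λ n → σ^ n (rep (cls j)) Finₚ.≟ j) {proj₁ (rep-cls j)} (proj₂ (rep-cls j))

    depth : Fin m → ℕ
    depth j = proj₁ (depth-search j)

    depth-spec : ∀ j → σ^ (depth j) (rep (cls j)) ≡ j
    depth-spec j = proj₁ (proj₂ (depth-search j))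

    depth-least : ∀ {j} t → σ^ t (rep (cls j)) ≡ j → depth j ≤ t
    depth-least {j} t = least-≤ (proj₂ (depth-search j))

    depth-injective : ∀ {i j} → cls i ≡ cls j → depth i ≡ depth j → i ≡ j
    depth-injective {i} {j} cᵢ≡cⱼ dᵢ≡dⱼ = begin
      i                               ≡⟨ depth-spec i ⟨
      σ^ (depth i) (rep (cls i))      ≡⟨ ≡.cong₂ (λ n l → σ^ n (rep l)) dᵢ≡dⱼ cᵢ≡cⱼ ⟩
      σ^ (depth j) (rep (cls j))      ≡⟨ depth-spec j ⟩
      j                               ∎
      where open ≡.≡-Reasoning

    depth-drop⇒return : ∀ {j} → depth (σ j) ≤ depth j → σ j ≡ rep (cls j)
    depth-drop⇒return {j} = go (depth (σ j)) spec
      where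
      spec : σ^ (depth (σ j)) (rep (cls j)) ≡ σ j
      spec = ≡.subst (λ l → σ^ (depth (σ j)) (rep l) ≡ σ j) (cls-σ j) (depth-spec (σ j))
      go : ∀ n → σ^ n (rep (cls j)) ≡ σ j → n ≤ depth j → σ j ≡ rep (cls j)
      go zero    σ⁰r≡σj _      = ≡.sym σ⁰r≡σj
      go (suc n) σ¹⁺ⁿr≡σj n<dⱼ =
        ⊥-elim (ℕₚ.<⇒≱ n<dⱼ (depth-least n (σ-injective σ¹⁺ⁿr≡σj)))

    return⇒depth-drop : ∀ {j} → σ j ≡ rep (cls j) → depth (σ j) ≤ depth j
    return⇒depth-drop {j} σj≡r = ℕₚ.≤-trans
      (depth-least 0 (≡.trans (≡.cong rep (cls-σ j)) (≡.sym σj≡r))) z≤n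

    -- Keys ordering the points of the cycles, plus a bottom element
    -- (nothing): the cycle index comes first, then the depth, decreasing.
    rank : Maybe (Fin m) → ℕ × ℕ
    rank nothing  = 0 , 0
    rank (just j) = suc (toℕ (cls j)) , depth j

    rank-injective : ∀ {a b} → ×-Pointwise.Pointwise _≡_ _≡_ (rank a) (rank b) → a ≡ b
    rank-injective {nothing} {nothing} _       = ≡.refl
    rank-injective {nothing} {just _}  (() , _)
    rank-injective {just _}  {nothing} (() , _)
    rank-injective {just i}  {just j}  (e₁ , e₂) =
      ≡.cong just (depth-injective (Finₚ.toℕ-injective (ℕₚ.suc-injective e₁)) e₂)

    rank-rise⇒return : ∀ {j} → rank (just j) ⊑ rank (just (σ j)) → σ j ≡ rep (cls j)
    rank-rise⇒return {j} (inj₁ (_ , different)) =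
      ⊥-elim (different (≡.cong (λ l → suc (toℕ l)) (≡.sym (cls-σ j))))
    rank-rise⇒return (inj₂ (_ , drop)) = depth-drop⇒return drop

    return⇒rank-rise : ∀ {j} → σ j ≡ rep (cls j) → rank (just j) ⊑ rank (just (σ j))
    return⇒rank-rise {j} σj≡r =
      inj₂ (≡.cong (λ l → suc (toℕ l)) (≡.sym (cls-σ j)) , return⇒depth-drop σj≡r)

module HurwitzMoves {c ℓ a : Level} (G : Group c ℓ) (A : Pred (Group.Carrier G) a)
  (A-resp : ∀ {x y} → Group._≈_ G x y → A x → A y)
  (A-conj : ∀ g x → A x → A (Group._∙_ G (Group._∙_ G (Group._⁻¹ G g) x) g)) where

  open Group G
  open GroupProperties G
    using (⁻¹-involutive; \\-leftDividesˡ; \\-leftDividesʳ; //-rightDividesˡ; //-rightDividesʳ)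

  _≋_ : Rel (List Carrier) (c ⊔ ℓ)
  _≋_ = Pointwise _≈_

  ≋-refl : ∀ {w} → w ≋ w
  ≋-refl = Pointwise.refl refl

  ≋-sym : ∀ {w v} → w ≋ v → v ≋ w
  ≋-sym = Pointwise.symmetric sym

  ≋-trans : ∀ {u v w} → u ≋ v → v ≋ w → u ≋ w
  ≋-trans = Pointwise.transitive trans

  ≈Red-isEquivalence : ∀ {x} → IsEquivalence (_≈Red_ G A {x})
  ≈Red-isEquivalence = On.isEquivalence proj₁ (Pointwise.isEquivalence isEquivalence)

  conj-past : ∀ x y → y ∙ ((y ⁻¹ ∙ x) ∙ y) ≈ x ∙ y
  conj-past x y = trans (sym (assoc _ _ _)) (∙-congʳ (\\-leftDividesˡ y x))

  regroup : ∀ {u v x y} p → u ∙ v ≈ x ∙ y → u ∙ (v ∙ p) ≈ x ∙ (y ∙ p)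
  regroup p uv≈xy = trans (sym (assoc _ _ _)) (trans (∙-congʳ uv≈xy) (assoc _ _ _))

  hurwitz-IsRed : ∀ {x w} → IsRed G A x w → IsRed G A x (hurwitz G w)
  hurwitz-IsRed {w = []}    r = r
  hurwitz-IsRed {w = _ ∷ []} r = r
  hurwitz-IsRed {w = u ∷ v ∷ rest} (A-u ∷ A-v ∷ A-rest , product , minimal) =
    (A-v ∷ A-conj v u A-u ∷ A-rest) ,
    trans (regroup (prod G rest) (conj-past u v)) product ,
    minimal

  hurwitzInv-IsRed : ∀ {x w} → IsRed G A x w → IsRed G A x (hurwitzInv G w)
  hurwitzInv-IsRed {w = []}    r = r
  hurwitzInv-IsRed {w = _ ∷ []} r = r
  hurwitzInv-IsRed {w = u ∷ v ∷ rest} (A-u ∷ A-v ∷ A-rest , product , minimal) =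
    (A-resp (∙-congʳ (∙-congʳ (⁻¹-involutive u))) (A-conj (u ⁻¹) v A-v) ∷ A-u ∷ A-rest) ,
    trans (regroup (prod G rest) (//-rightDividesˡ u (u ∙ v))) product ,
    minimal

  hurwitz-resp : ∀ {w v} → w ≋ v → hurwitz G w ≋ hurwitz G v
  hurwitz-resp []           = []
  hurwitz-resp (p ∷ [])     = p ∷ []
  hurwitz-resp (p ∷ q ∷ ps) = q ∷ ∙-cong (∙-cong (⁻¹-cong q) p) q ∷ ps

  hurwitzInv-resp : ∀ {w v} → w ≋ v → hurwitzInv G w ≋ hurwitzInv G v
  hurwitzInv-resp []           = []
  hurwitzInv-resp (p ∷ [])     = p ∷ []
  hurwitzInv-resp (p ∷ q ∷ ps) = ∙-cong (∙-cong p q) (⁻¹-cong p) ∷ p ∷ ps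

  hurwitzInv-hurwitz : ∀ w → hurwitzInv G (hurwitz G w) ≋ w
  hurwitzInv-hurwitz []             = []
  hurwitzInv-hurwitz (u ∷ [])       = refl ∷ []
  hurwitzInv-hurwitz (u ∷ v ∷ rest) =
    trans (∙-congʳ (conj-past u v)) (//-rightDividesʳ v u) ∷ refl ∷ ≋-refl

  hurwitz-hurwitzInv : ∀ w → hurwitz G (hurwitzInv G w) ≋ w
  hurwitz-hurwitzInv []             = []
  hurwitz-hurwitzInv (u ∷ [])       = refl ∷ []
  hurwitz-hurwitzInv (u ∷ v ∷ rest) =
    refl ∷
    trans (assoc _ _ _) (trans (∙-congˡ (//-rightDividesˡ u (u ∙ v))) (\\-leftDividesʳ u v)) ∷
    ≋-refl

  module _ {x : Carrier} where

    hurwitzRed hurwitzInvRed : Red G A x → Red G A x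
    hurwitzRed    (w , r) = hurwitz G w , hurwitz-IsRed r
    hurwitzInvRed (w , r) = hurwitzInv G w , hurwitzInv-IsRed r

    iter-IsRed : ∀ {f} → (∀ {w} → IsRed G A x w → IsRed G A x (f w)) →
      ∀ n {w} → IsRed G A x w → IsRed G A x (iter G f n w)
    iter-IsRed f-red zero    r = r
    iter-IsRed f-red (suc n) r = f-red (iter-IsRed f-red n r)

    actRed : ℤ → Red G A x → Red G A x
    actRed (+ n)    (w , r) = act G (+ n) w , iter-IsRed hurwitz-IsRed n r
    actRed -[1+ n ] (w , r) = act G -[1+ n ] w , iter-IsRed hurwitzInv-IsRed (suc n) r

module LengthTwo {c ℓ a : Level} (G : Group c ℓ) (A : Pred (Group.Carrier G) a)
  (A-resp : ∀ {x y} → Group._≈_ G x y → A x → A y)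
  (A-conj : ∀ g x → A x → A (Group._∙_ G (Group._∙_ G (Group._⁻¹ G g) x) g))
  (cc : Group.Carrier G) (ℓc≡2 : IsLength G A cc 2) where

  open Group G
  open GroupProperties G using (\\-leftDividesˡ; \\-leftDividesʳ)
  open HurwitzMoves G A A-resp A-conj

  RedC : Set (c ⊔ ℓ ⊔ a)
  RedC = Red G A cc

  SubC : Set (c ⊔ ℓ ⊔ a)
  SubC = Sub G A cc

  _≈S_ : Rel SubC ℓ
  _≈S_ = _≈Sub_ G A {cc}

  length-unique : ∀ {x y i j} → x ≈ y → IsLength G A x i → IsLength G A y j → i ≡ j
  length-unique x≈y ((w , |w|≡i , A-w , w≈x) , minimal-x) ((v , |v|≡j , A-v , v≈y) , minimal-y) =
    ℕₚ.≤-antisym (≡.subst (_ ≤_) |v|≡j (minimal-x v A-v (trans v≈y (sym x≈y))))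
                 (≡.subst (_ ≤_) |w|≡i (minimal-y w A-w (trans w≈x x≈y)))

  length-resp : ∀ {x y i} → x ≈ y → IsLength G A x i → IsLength G A y i
  length-resp x≈y ((w , |w|≡i , A-w , w≈x) , minimal) =
    (w , |w|≡i , A-w , trans w≈x x≈y) , λ v A-v v≈y → minimal v A-v (trans v≈y (sym x≈y))

  length-zero : ∀ {b} → IsLength G A b 0 → ε ≈ b
  length-zero (([] , _ , _ , ε≈b) , _) = ε≈b

  length-one-letter : ∀ {b} → IsLength G A b 1 → A b
  length-one-letter ((u ∷ [] , _ , A-u ∷ [] , u∙ε≈b) , _) =
    A-resp (trans (sym (identityʳ u)) u∙ε≈b) A-u

  letter-length-one : ∀ {b} → A b → ¬ (ε ≈ b) → IsLength G A b 1
  letter-length-one {b} A-b ε≉b = ((b ∷ []) , ≡.refl , A-b ∷ [] , identityʳ b) , minimal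
    where
    minimal : ∀ w → _ → prod G w ≈ b → 1 ≤ length w
    minimal []      _ ε≈b = ⊥-elim (ε≉b ε≈b)
    minimal (_ ∷ _) _ _   = s≤s z≤n

  letter-not-long : ∀ {b i} → A b → ¬ IsLength G A b (2 + i)
  letter-not-long A-b (_ , minimal) with minimal (_ ∷ []) (A-b ∷ []) (identityʳ _)
  ... | s≤s ()

  c-not-letter : ∀ {b} → A b → ¬ (b ≈ cc)
  c-not-letter A-b b≈c = letter-not-long A-b (length-resp (sym b≈c) ℓc≡2)

  module _ {x y} (A-x : A x) (A-y : A y) (xy≈c : x ∙ (y ∙ ε) ≈ cc) where

    first-nontrivial : ¬ (ε ≈ x)
    first-nontrivial ε≈x = c-not-letter A-y
      (trans (sym (identityʳ y)) (trans (sym (identityˡ _)) (trans (∙-congʳ ε≈x) xy≈c)))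

    second-nontrivial : ¬ (ε ≈ y)
    second-nontrivial ε≈y = c-not-letter A-x
      (trans (sym (identityʳ x)) (trans (∙-congˡ (trans ε≈y (sym (identityʳ y)))) xy≈c))

    second-complement : x ⁻¹ ∙ cc ≈ y
    second-complement =
      trans (∙-congˡ (sym xy≈c)) (trans (\\-leftDividesʳ x (y ∙ ε)) (identityʳ y))

    first-below-c : _≤A_ G A x cc
    first-below-c =
      1 , 1 , 2 ,
      letter-length-one A-x first-nontrivial ,
      length-resp (sym second-complement) (letter-length-one A-y second-nontrivial) ,
      ℓc≡2 , ≡.refl

  twoLetters : ∀ {w} → IsRed G A cc w → ∃₂ λ x y → w ≡ x ∷ y ∷ []
  twoLetters {x ∷ y ∷ []} _ = x , y , ≡.refl
  twoLetters {[]} (_ , _ , ℓ) with length-unique refl ℓ ℓc≡2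
  ... | ()
  twoLetters {_ ∷ []} (_ , _ , ℓ) with length-unique refl ℓ ℓc≡2
  ... | ()
  twoLetters {_ ∷ _ ∷ _ ∷ _} (_ , _ , ℓ) with length-unique refl ℓ ℓc≡2
  ... | ()

  first : RedC → SubC
  first (w , r) with twoLetters r
  first (_ , (A-x ∷ A-y ∷ [] , xy≈c , _)) | x , y , ≡.refl =
    x , A-x , first-below-c A-x A-y xy≈c

  first-shape : ∀ u → proj₁ u ≋ (proj₁ (first u) ∷ proj₁ (first (hurwitzRed u)) ∷ [])
  first-shape (w , r) with twoLetters r
  first-shape (_ , (_ ∷ _ ∷ [] , _ , _)) | x , y , ≡.refl = refl ∷ refl ∷ []

  first-resp : ∀ {u v} → _≈Red_ G A u v → first u ≈S first v
  first-resp {u} {v} u≈v with ≋-trans (≋-sym (first-shape u)) (≋-trans u≈v (first-shape v))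
  ... | x≈x′ ∷ _ = x≈x′

  rising-intro : ∀ {o} (_≼_ : Rel SubC o) u →
    first u ≼ first (hurwitzRed u) → Rising G A cc _≼_ (proj₁ u)
  rising-intro _≼_ (w , r) rise with twoLetters r
  rising-intro _≼_ (_ , (_ ∷ _ ∷ [] , _ , _)) rise | x , y , ≡.refl = _ , _ , rise , tt

  rising-elim : ∀ {o} {_≼_ : Rel SubC o} → IsTotalOrder _≈S_ _≼_ →
    ∀ u → Rising G A cc _≼_ (proj₁ u) → first u ≼ first (hurwitzRed u)
  rising-elim ≼-order (w , r) rise with twoLetters r
  rising-elim ≼-order (_ , (_ ∷ _ ∷ [] , _ , _)) (_ , _ , x≼y , _) | x , y , ≡.refl =
    ≲-respˡ-≈ refl (≲-respʳ-≈ refl x≼y)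
    where open IsTotalOrder ≼-order using (≲-respˡ-≈; ≲-respʳ-≈)

  pairWith : ∀ {b} → A b → A (b ⁻¹ ∙ cc) → RedC
  pairWith {b} A-b A-b⁻¹c =
    (b ∷ (b ⁻¹ ∙ cc) ∷ []) , (A-b ∷ A-b⁻¹c ∷ []) ,
    trans (∙-congˡ (identityʳ _)) (\\-leftDividesˡ b cc) , ℓc≡2

  complement-letter : ∀ {b j k} → IsLength G A (b ⁻¹ ∙ cc) j → IsLength G A cc k →
    1 + j ≡ k → A (b ⁻¹ ∙ cc)
  complement-letter L-j L-k 1+j≡k = length-one-letter
    (≡.subst (IsLength G A _) (ℕₚ.suc-injective (≡.trans 1+j≡k (length-unique refl L-k ℓc≡2))) L-j)

module HurwitzOrbits {c ℓ a : Level} (G : Group c ℓ) (A : Pred (Group.Carrier G) a)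
  (A-resp : ∀ {x y} → Group._≈_ G x y → A x → A y)
  (A-conj : ∀ g x → A x → A (Group._∙_ G (Group._∙_ G (Group._⁻¹ G g) x) g))
  (cc : Group.Carrier G) (ℓc≡2 : IsLength G A cc 2)
  {m : ℕ} (enumRed : HasCard (Red G A cc) (_≈Red_ G A) m) where

  open Group G
  open HurwitzMoves G A A-resp A-conj
  open LengthTwo G A A-resp A-conj cc ℓc≡2
  open Enumeration ≈Red-isEquivalence enumRed
    renaming (enum to E; enum-injective to E-injective; index to idx;
              enum-index to E-idx; index-enum to idx-E; index-resp to idx-resp;
              index-injective to idx-injective)

  σ σ⁻ : Fin m → Fin m
  σ  j = idx (hurwitzRed (E j))
  σ⁻ j = idx (hurwitzInvRed (E j))

  idx-hurwitz : ∀ u → idx (hurwitzRed u) ≡ σ (idx u)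
  idx-hurwitz u = idx-resp (hurwitz-resp (≋-sym (E-idx u)))

  idx-hurwitzInv : ∀ u → idx (hurwitzInvRed u) ≡ σ⁻ (idx u)
  idx-hurwitzInv u = idx-resp (hurwitzInv-resp (≋-sym (E-idx u)))

  σ⁻∘σ : ∀ j → σ⁻ (σ j) ≡ j
  σ⁻∘σ j = ≡.trans (≡.sym (idx-hurwitzInv (hurwitzRed (E j))))
                   (≡.trans (idx-resp (hurwitzInv-hurwitz (proj₁ (E j)))) (idx-E j))

  σ∘σ⁻ : ∀ j → σ (σ⁻ j) ≡ j
  σ∘σ⁻ j = ≡.trans (≡.sym (idx-hurwitz (hurwitzInvRed (E j))))
                   (≡.trans (idx-resp (hurwitz-hurwitzInv (proj₁ (E j)))) (idx-E j))

  open Permutation σ σ⁻ σ⁻∘σ σ∘σ⁻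

  idx-act⁺ : ∀ n u → idx (actRed (+ n) u) ≡ σ^ n (idx u)
  idx-act⁺ zero    u = ≡.refl
  idx-act⁺ (suc n) u =
    ≡.trans (idx-hurwitz (actRed (+ n) u)) (≡.cong σ (idx-act⁺ n u))

  σ-idx-hurwitzInv : ∀ u → σ (idx (hurwitzInvRed u)) ≡ idx u
  σ-idx-hurwitzInv u = ≡.trans (≡.sym (idx-hurwitz (hurwitzInvRed u)))
                               (idx-resp (hurwitz-hurwitzInv (proj₁ u)))

  Orb-act⁻ : ∀ n u → Orb (idx (actRed -[1+ n ] u)) (idx u)
  Orb-act⁻ zero    u = 1 , σ-idx-hurwitzInv u
  Orb-act⁻ (suc n) u =
    Orb-trans (1 , σ-idx-hurwitzInv (actRed -[1+ n ] u)) (Orb-act⁻ n u)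

  sameOrbit⇒Orb : ∀ {u v} → SameOrbit G A u v → Orb (idx u) (idx v)
  sameOrbit⇒Orb {u} (+ n , uⁿ≋v) = n , ≡.trans (≡.sym (idx-act⁺ n u)) (idx-resp uⁿ≋v)
  sameOrbit⇒Orb {u} (-[1+ n ] , u⁻ⁿ≋v) =
    Orb-sym (≡.subst (λ j → Orb j (idx u)) (idx-resp u⁻ⁿ≋v) (Orb-act⁻ n u))

  Orb⇒sameOrbit : ∀ {u v} → Orb (idx u) (idx v) → SameOrbit G A u v
  Orb⇒sameOrbit {u} (n , σⁿu≡v) = + n , idx-injective (≡.trans (idx-act⁺ n u) σⁿu≡v)

  ≈Sub-isEquivalence : IsEquivalence _≈S_
  ≈Sub-isEquivalence = On.isEquivalence proj₁ isEquivalence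

  ≈Rising-isEquivalence : ∀ {o} {_≼_ : Rel SubC o} → IsEquivalence (_≈Rising_ G A {_≼_ = _≼_})
  ≈Rising-isEquivalence = On.isEquivalence (λ u → proj₁ (proj₁ u)) (Pointwise.isEquivalence isEquivalence)

  first-σ : ∀ j → first (E (σ j)) ≈S first (hurwitzRed (E j))
  first-σ j = first-resp {E (σ j)} {hurwitzRed (E j)} (E-idx (hurwitzRed (E j)))

  -- The letter index of s ∈ A_c: nothing if s is trivial, and otherwise the
  -- index of the reduced factorization (s , s⁻¹c).
  letterIndex : SubC → Maybe (Fin m)
  letterIndex (_ , _   , zero          , _) = nothing
  letterIndex (_ , A-b , suc zero      , _ , _ , _ , L-j , L-c , e) =
    just (idx (pairWith A-b (complement-letter L-j L-c e)))
  letterIndex (_ , A-b , suc (suc _)   , _ , _ , L-b , _) = ⊥-elim (letter-not-long A-b L-b)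

  letterIndex-resp : ∀ {s t} → s ≈S t → letterIndex s ≡ letterIndex t
  letterIndex-resp {_ , _ , zero , _} {_ , _ , zero , _} _ = ≡.refl
  letterIndex-resp {_ , _ , zero , _ , _ , L , _} {_ , _ , suc zero , _ , _ , L′ , _} s≈t
    with length-unique s≈t L L′
  ... | ()
  letterIndex-resp {_ , _ , suc zero , _ , _ , L , _} {_ , _ , zero , _ , _ , L′ , _} s≈t
    with length-unique s≈t L L′
  ... | ()
  letterIndex-resp {_ , _ , suc zero , _} {_ , _ , suc zero , _} s≈t =
    ≡.cong just (idx-resp (s≈t ∷ ∙-congʳ (⁻¹-cong s≈t) ∷ []))
  letterIndex-resp {_ , A-b , suc (suc _) , _ , _ , L , _} _ = ⊥-elim (letter-not-long A-b L)
  letterIndex-resp {t = _ , A-b , suc (suc _) , _ , _ , L , _} _ = ⊥-elim (letter-not-long A-b L)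

  letterIndex-injective : ∀ {s t} → letterIndex s ≡ letterIndex t → s ≈S t
  letterIndex-injective {_ , _ , zero , _ , _ , L , _} {_ , _ , zero , _ , _ , L′ , _} _ =
    trans (sym (length-zero L)) (length-zero L′)
  letterIndex-injective {_ , _ , suc zero , _} {_ , _ , suc zero , _} e
    with idx-injective (Maybeₚ.just-injective e)
  ... | b≈b′ ∷ _ = b≈b′
  letterIndex-injective {_ , A-b , suc (suc _) , _ , _ , L , _} _ = ⊥-elim (letter-not-long A-b L)
  letterIndex-injective {t = _ , A-b , suc (suc _) , _ , _ , L , _} _ = ⊥-elim (letter-not-long A-b L)

  letterIndex-first : ∀ u → letterIndex (first u) ≡ just (idx u)
  letterIndex-first (w , r) with twoLetters r
  letterIndex-first (_ , (A-x ∷ A-y ∷ [] , xy≈c , _)) | x , y , ≡.refl =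
    ≡.cong just (idx-resp (refl ∷ second-complement A-x A-y xy≈c ∷ []))

  letterIndex-first-σ : ∀ u → letterIndex (first (hurwitzRed u)) ≡ just (σ (idx u))
  letterIndex-first-σ u = ≡.trans (letterIndex-first (hurwitzRed u)) (≡.cong just (idx-hurwitz u))

  module WithOrbits {k : ℕ} (orbits : HasCard RedC (SameOrbit G A) k) where

    rep : Fin k → Fin m
    rep i = idx (proj₁ orbits i)

    cls : Fin m → Fin k
    cls j = proj₁ (proj₂ (proj₂ orbits) (E j))

    rep-cls : ∀ j → Orb (rep (cls j)) j
    rep-cls j = ≡.subst (Orb _) (idx-E j) (sameOrbit⇒Orb (proj₂ (proj₂ (proj₂ orbits) (E j))))

    cls-unique : ∀ {i j} → Orb (rep i) j → cls j ≡ i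
    cls-unique {i} {j} rᵢ⇝j = ≡.sym (proj₁ (proj₂ orbits) i (cls j)
      (Orb⇒sameOrbit (Orb-trans rᵢ⇝j (Orb-sym (rep-cls j)))))

    open Cycles rep cls rep-cls cls-unique

    -- orb(c) ≤ rise(c;≼) for every linear order ≼ on A_c: a rise chosen in
    -- each cycle gives an injection from orbits into rising factorizations.
    orbits≤risings : ∀ {o} (_≼_ : Rel SubC o) → IsLinearOrder G A cc _≼_ →
      ∀ r → HasCard (RisingRed G A cc _≼_) (_≈Rising_ G A) r → k ≤ r
    orbits≤risings _≼_ ≼-order r risings = Finₚ.injective⇒≤ {f = ρ} ρ-injective
      where
      open IsTotalOrder ≼-order using (total; ≲-respʳ-≈)
        renaming (reflexive to ≼-reflexive; trans to ≼-trans)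
      open Enumeration ≈Rising-isEquivalence risings using (index; index-injective)

      _R_ : Rel (Fin m) _
      j R j′ = first (E j) ≼ first (E j′)

      chosen : ∀ i → ∃ λ j → cls j ≡ i × j R σ j
      chosen = rise-in-cycle _R_ (λ {j} → ≼-reflexive {first (E j)} {first (E j)} refl)
        (λ {j} {j′} {j″} → ≼-trans {first (E j)} {first (E j′)} {first (E j″)})
        (λ j j′ → total (first (E j)) (first (E j′)))

      rising : Fin k → RisingRed G A cc _≼_
      rising i = E j , rising-intro _≼_ (E j)
        (≲-respʳ-≈ {first (E j)} {first (E (σ j))} {first (hurwitzRed (E j))} (first-σ j) j-rise)
        where j = proj₁ (chosen i); j-rise = proj₂ (proj₂ (chosen i))

      ρ : Fin k → Fin r
      ρ i = index (rising i)

      ρ-injective : ∀ {i i′} → ρ i ≡ ρ i′ → i ≡ i′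
      ρ-injective {i} {i′} ρi≡ρi′ = ≡.trans (≡.sym (proj₁ (proj₂ (chosen i))))
        (≡.trans (≡.cong cls (E-injective (proj₁ (chosen i)) (proj₁ (chosen i′))
          (index-injective {rising i} {rising i′} ρi≡ρi′))) (proj₁ (proj₂ (chosen i′))))

    -- The optimal order: A_c ordered by rank ∘ letterIndex, i.e. the trivial
    -- letter first, then by orbit, and within an orbit by decreasing depth.
    module OptimalOrder (o : Level) where

      _≼_ : Rel SubC o
      s ≼ t = Lift o (rank (letterIndex s) ⊑ rank (letterIndex t))

      isLinearOrder : IsLinearOrder G A cc _≼_
      isLinearOrder = pullback-isTotalOrder o ≈Sub-isEquivalence ⊑-isTotalOrder
        (λ s → rank (letterIndex s))
        (λ {s} {t} s≈t → ×-Pointwise.≡⇒≡×≡ (≡.cong rank (letterIndex-resp {s} {t} s≈t)))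
        (λ {s} {t} keys≡ → letterIndex-injective {s} {t} (rank-injective keys≡))

      rising⇒return : ∀ u → Rising G A cc _≼_ (proj₁ u) → σ (idx u) ≡ rep (cls (idx u))
      rising⇒return u rise = rank-rise⇒return
        (≡.subst₂ (λ a b → rank a ⊑ rank b) (letterIndex-first u) (letterIndex-first-σ u)
          (lower (rising-elim isLinearOrder u rise)))

      return⇒rising : ∀ u → σ (idx u) ≡ rep (cls (idx u)) → Rising G A cc _≼_ (proj₁ u)
      return⇒rising u returns = rising-intro _≼_ u (lift
        (≡.subst₂ (λ a b → rank a ⊑ rank b) (≡.sym (letterIndex-first u)) (≡.sym (letterIndex-first-σ u))
          (return⇒rank-rise returns)))

      pre : Fin k → Fin m
      pre i = σ⁻ (rep i)

      cls-pre : ∀ i → cls (pre i) ≡ i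
      cls-pre i = ≡.trans (≡.sym (cls-σ (pre i))) (≡.trans (≡.cong cls (σ∘σ⁻ (rep i))) (cls-rep i))

      pre-returns : ∀ i → σ (idx (E (pre i))) ≡ rep (cls (idx (E (pre i))))
      pre-returns i rewrite idx-E (pre i) | cls-pre i = σ∘σ⁻ (rep i)

      risings≡orbits : HasCard (RisingRed G A cc _≼_) (_≈Rising_ G A) k
      risings≡orbits = risingIn , risingIn-injective , risingIn-onto
        where
        risingIn : Fin k → RisingRed G A cc _≼_
        risingIn i = E (pre i) , return⇒rising (E (pre i)) (pre-returns i)

        risingIn-injective : ∀ i i′ → _≈Rising_ G A (risingIn i) (risingIn i′) → i ≡ i′
        risingIn-injective i i′ same = begin
          i                ≡⟨ cls-rep i ⟨
          cls (rep i)      ≡⟨ ≡.cong cls (σ∘σ⁻ (rep i)) ⟨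
          cls (σ (pre i))  ≡⟨ ≡.cong (λ j → cls (σ j)) (E-injective _ _ same) ⟩
          cls (σ (pre i′)) ≡⟨ ≡.cong cls (σ∘σ⁻ (rep i′)) ⟩
          cls (rep i′)     ≡⟨ cls-rep i′ ⟩
          i′               ∎
          where open ≡.≡-Reasoning

        risingIn-onto : ∀ v → ∃ λ i → _≈Rising_ G A (risingIn i) v
        risingIn-onto (u , rise) = cls (idx u) ,
          ≡.subst (λ j → _≈Red_ G A (E j) u) (≡.sym pre≡u) (E-idx u)
          where
          pre≡u : pre (cls (idx u)) ≡ idx u
          pre≡u = ≡.trans (≡.cong σ⁻ (≡.sym (rising⇒return u rise))) (σ⁻∘σ (idx u))

proposition5p1 : ∀ {c ℓ a o : Level} (G : Group c ℓ) (A : Pred (Group.Carrier G) a) →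
  (∀ {x y} → Group._≈_ G x y → A x → A y) →
  (∀ x → ∃[ w ] (All A w × Group._≈_ G (prod G w) x)) →
  (∀ g x → A x → A (Group._∙_ G (Group._∙_ G (Group._⁻¹ G g) x) g)) →
  (cc : Group.Carrier G) →
  IsLength G A cc 2 →
  (∃[ m ] HasCard (Red G A cc) (_≈Red_ G A) m) →
  (k : ℕ) → HasCard (Red G A cc) (SameOrbit G A) k →
  ((_≼_ : Rel (Sub G A cc) o) → IsLinearOrder G A cc _≼_ →
      (r : ℕ) → HasCard (RisingRed G A cc _≼_) (_≈Rising_ G A) r → k ≤ r)
  × (Σ (Rel (Sub G A cc) o) λ _≼_ → IsLinearOrder G A cc _≼_ ×
      HasCard (RisingRed G A cc _≼_) (_≈Rising_ G A) k)
proposition5p1 {o = o} G A A-resp _ A-conj cc ℓc≡2 (m , enumRed) k orbits =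
  orbits≤risings , (_≼_ , isLinearOrder , risings≡orbits)
  where
  open HurwitzOrbits G A A-resp A-conj cc ℓc≡2 enumRed
  open WithOrbits orbits
  open OptimalOrder o
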